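{- Let $M$ be a $\lambda\mathrm{Y}$ term whose occurrences of recursion constants are $\mathrm{Y}_{\sigma_1},\ldots,\mathrm{Y}_{\sigma_k}$, let $n_1,\ldots,n_k\in\mathbb{N}$, and let $K$ be a term of the typed $\lambda\beta\eta$-calculus. If $\vdash_{\lambda\Omega^+}M^{(n_1,\ldots,n_k)}=K$ then $\vdash_{\lambda\mathrm{Y}}M=K$.
   Context: Simple types are built from a ground type $o$ with $\to$. The $\lambda\Omega^+$-calculus is the typed (Church-style) $\lambda\beta\eta$-calculus extended with constants $\Omega_\sigma:\sigma$ for every type $\sigma$, with no additional conversion rules. The $\lambda\mathrm{Y}$-calculus is the typed $\lambda\beta\eta$-calculus extended with constants $\mathrm{Y}_\sigma:(\sigma\to\sigma)\to\sigma$ for every type $\sigma$ and conversions $f(\mathrm{Y}_\sigma f)=\mathrm{Y}_\sigma f$. Define the $\lambda\Omega^+$ terms $\widetilde{\mathrm{Y}}^{(n)}_\sigma=\lambda f^{\sigma\to\sigma}.f^n(\Omega_\sigma)$. For a $\lambda\mathrm{Y}$ term $M[\mathrm{Y}_{\sigma_1},\ldots,\mathrm{Y}_{\sigma_k}]$ (displaying its occurrences of recursion constants) and $n_1,\ldots,n_k$, $M^{(n_1,\ldots,n_k)}$ denotes the $\lambda\Omega^+$ term $M[\widetilde{\mathrm{Y}}^{(n_1)}_{\sigma_1},\ldots,\widetilde{\mathrm{Y}}^{(n_k)}_{\sigma_k}]$. -}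

module Defs where

open import Data.Nat using (ℕ; zero; suc; _+_)
open import Data.Vec using (Vec; take; drop)
open import Data.Empty using (⊥)

infixr 7 _⇒_
data Ty : Set where
  o   : Ty
  _⇒_ : Ty → Ty → Ty

infixl 5 _,_
data Ctx : Set where
  ∅   : Ctx
  _,_ : Ctx → Ty → Ctx

infix 4 _∋_
data _∋_ : Ctx → Ty → Set where
  here  : ∀ {Γ σ} → Γ , σ ∋ σ
  there : ∀ {Γ σ τ} → Γ ∋ σ → Γ , τ ∋ σ

data Tm (C : Ty → Set) (Γ : Ctx) : Ty → Set where
  var : ∀ {σ} → Γ ∋ σ → Tm C Γ σ
  lam : ∀ {σ τ} → Tm C (Γ , σ) τ → Tm C Γ (σ ⇒ τ)
  app : ∀ {σ τ} → Tm C Γ (σ ⇒ τ) → Tm C Γ σ → Tm C Γ τ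
  con : ∀ {σ} → C σ → Tm C Γ σ

Ren : Ctx → Ctx → Set
Ren Γ Δ = ∀ {σ} → Γ ∋ σ → Δ ∋ σ

extR : ∀ {Γ Δ τ} → Ren Γ Δ → Ren (Γ , τ) (Δ , τ)
extR ρ here      = here
extR ρ (there x) = there (ρ x)

rename : ∀ {C Γ Δ σ} → Ren Γ Δ → Tm C Γ σ → Tm C Δ σ
rename ρ (var x)   = var (ρ x)
rename ρ (lam M)   = lam (rename (extR ρ) M)
rename ρ (app M N) = app (rename ρ M) (rename ρ N)
rename ρ (con c)   = con c

weaken : ∀ {C Γ σ τ} → Tm C Γ σ → Tm C (Γ , τ) σ
weaken = rename there

Sub : (Ty → Set) → Ctx → Ctx → Set
Sub C Γ Δ = ∀ {σ} → Γ ∋ σ → Tm C Δ σ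

extS : ∀ {C Γ Δ τ} → Sub C Γ Δ → Sub C (Γ , τ) (Δ , τ)
extS s here      = var here
extS s (there x) = weaken (s x)

subst : ∀ {C Γ Δ σ} → Sub C Γ Δ → Tm C Γ σ → Tm C Δ σ
subst s (var x)   = s x
subst s (lam M)   = lam (subst (extS s) M)
subst s (app M N) = app (subst s M) (subst s N)
subst s (con c)   = con c

single : ∀ {C Γ τ} → Tm C Γ τ → Sub C (Γ , τ) Γ
single N here      = N
single N (there x) = var x

_[_] : ∀ {C Γ σ τ} → Tm C (Γ , τ) σ → Tm C Γ τ → Tm C Γ σ
M [ N ] = subst (single N) M

Axioms : (Ty → Set) → Set₁
Axioms C = ∀ {Γ σ} → Tm C Γ σ → Tm C Γ σ → Set

infix 3 _⊢_≈_
data _⊢_≈_ {C : Ty → Set} (Ax : Axioms C) {Γ : Ctx} :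
           ∀ {σ} → Tm C Γ σ → Tm C Γ σ → Set where
  ax    : ∀ {σ} {M N : Tm C Γ σ} → Ax M N → Ax ⊢ M ≈ N
  refl  : ∀ {σ} {M : Tm C Γ σ} → Ax ⊢ M ≈ M
  sym   : ∀ {σ} {M N : Tm C Γ σ} → Ax ⊢ M ≈ N → Ax ⊢ N ≈ M
  trans : ∀ {σ} {M N P : Tm C Γ σ} → Ax ⊢ M ≈ N → Ax ⊢ N ≈ P → Ax ⊢ M ≈ P
  app   : ∀ {σ τ} {M M' : Tm C Γ (σ ⇒ τ)} {N N' : Tm C Γ σ} →
          Ax ⊢ M ≈ M' → Ax ⊢ N ≈ N' → Ax ⊢ app M N ≈ app M' N'
  lam   : ∀ {σ τ} {M M' : Tm C (Γ , σ) τ} →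
          _⊢_≈_ Ax {Γ , σ} M M' → Ax ⊢ lam M ≈ lam M'
  β     : ∀ {σ τ} (M : Tm C (Γ , σ) τ) (N : Tm C Γ σ) →
          Ax ⊢ app (lam M) N ≈ M [ N ]
  η     : ∀ {σ τ} (M : Tm C Γ (σ ⇒ τ)) →
          Ax ⊢ lam (app (weaken M) (var here)) ≈ M

data NoCon : Ty → Set where

data ΩCon : Ty → Set where
  Ω : (σ : Ty) → ΩCon σ

noAx : Axioms ΩCon
noAx _ _ = ⊥

data YCon : Ty → Set where
  Y : (σ : Ty) → YCon ((σ ⇒ σ) ⇒ σ)

data YAx : Axioms YCon where
  fix : ∀ {Γ σ} (f : Tm YCon Γ (σ ⇒ σ)) →
        YAx (app f (app (con (Y σ)) f)) (app (con (Y σ)) f)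

embed : ∀ {C Γ σ} → Tm NoCon Γ σ → Tm C Γ σ
embed (var x)   = var x
embed (lam M)   = lam (embed M)
embed (app M N) = app (embed M) (embed N)
embed (con ())

iterΩ : ∀ {Γ} (σ : Ty) → ℕ → Tm ΩCon (Γ , σ ⇒ σ) σ
iterΩ σ zero    = con (Ω σ)
iterΩ σ (suc n) = app (var here) (iterΩ σ n)

Ỹ : ∀ {Γ} (σ : Ty) → ℕ → Tm ΩCon Γ ((σ ⇒ σ) ⇒ σ)
Ỹ σ n = lam (iterΩ σ n)

occ : ∀ {Γ σ} → Tm YCon Γ σ → ℕ
occ (var x)   = 0
occ (lam M)   = occ M
occ (app M N) = occ M + occ N
occ (con c)   = 1

-- M^(n₁,…,n_k): replace the i-th occurrence Y_{σᵢ} (left-to-right) by Ỹ^(nᵢ)_{σᵢ}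
approx : ∀ {Γ σ} (M : Tm YCon Γ σ) → Vec ℕ (occ M) → Tm ΩCon Γ σ
approx (var x)       ns = var x
approx (lam M)       ns = lam (approx M ns)
approx (app M N)     ns = app (approx M (take (occ M) ns)) (approx N (drop (occ M) ns))
approx (con (Y σ))   ns = Ỹ σ (Data.Vec.head ns)

{-# OPTIONS --safe #-}
module Submission where

-- The proof is semantic. Interpret λΩ⁺ in a normalisation-by-evaluation model whose
-- base values are context-indexed families of partial λY terms, with Ω the nowhere
-- defined value. Convertible λΩ⁺ terms denote equivalent values, so the read-backs of
-- M^(n) and K agree wherever both are defined. A Kripke logical relation shows that
-- whatever is read back from M^(n) is λY-equal to M, because Y f = f (Y f) can stand in
-- for every fⁿ(Ω), and that the read-back of the pure term K is defined and λY-equal to K.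

open import Defs
open import Data.Bool using (if_then_else_)
open import Data.Maybe using (Maybe; just; nothing; map; zipWith)
open import Data.Maybe.Relation.Binary.Pointwise as Pointwise using (Pointwise; just; nothing)
open import Data.Maybe.Relation.Unary.All as All using (All; just; nothing)
open import Data.Maybe.Relation.Unary.Any as Any using (Any; just)
open import Data.Nat using (ℕ; zero; suc; _<_; _≤_; _≟_)
open import Data.Nat.Properties using (≤-refl; m≤n⇒m≤1+n; <-≤-trans; <⇒≢)
open import Data.Vec using (Vec; head)
open import Relation.Binary.Definitions using (DecidableEquality)
open import Relation.Binary.PropositionalEquality as ≡
  using (_≡_; refl; cong; cong₂; ≡-≟-identity)
open import Relation.Nullary.Decidable using (Dec; yes; no; does; dec-true; dec-false)

private variable
  C : Ty → Set
  Γ Δ Θ : Ctx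
  σ τ : Ty

-- Renaming and substitution

infix 4 _≐_
_≐_ : {F : Ty → Set} →
      (∀ {τ} → Γ ∋ τ → F τ) → (∀ {τ} → Γ ∋ τ → F τ) → Set
f ≐ g = ∀ {τ} x → f {τ} x ≡ g x

extR-cong : {r r' : Ren Γ Δ} → r ≐ r' → extR {τ = τ} r ≐ extR r'
extR-cong e here      = refl
extR-cong e (there x) = cong there (e x)

extR-id : extR {Γ} {τ = τ} (λ x → x) ≐ λ x → x
extR-id here      = refl
extR-id (there x) = refl

extR-∘ : (r' : Ren Δ Θ) (r : Ren Γ Δ) →
         (λ x → extR {τ = τ} r' (extR r x)) ≐ extR (λ x → r' (r x))
extR-∘ r' r here      = refl
extR-∘ r' r (there x) = refl

extS-cong : {s s' : Sub C Γ Δ} → s ≐ s' → extS {τ = τ} s ≐ extS s'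
extS-cong e here      = refl
extS-cong e (there x) = cong weaken (e x)

rename-cong : {r r' : Ren Γ Δ} → r ≐ r' → (M : Tm C Γ σ) → rename r M ≡ rename r' M
rename-cong e (var x)   = cong var (e x)
rename-cong e (lam M)   = cong lam (rename-cong (extR-cong e) M)
rename-cong e (app M N) = cong₂ app (rename-cong e M) (rename-cong e N)
rename-cong e (con c)   = refl

subst-cong : {s s' : Sub C Γ Δ} → s ≐ s' → (M : Tm C Γ σ) → subst s M ≡ subst s' M
subst-cong e (var x)   = e x
subst-cong e (lam M)   = cong lam (subst-cong (extS-cong e) M)
subst-cong e (app M N) = cong₂ app (subst-cong e M) (subst-cong e N)
subst-cong e (con c)   = refl

rename-id : (M : Tm C Γ σ) → rename (λ x → x) M ≡ M
rename-id (var x)   = refl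
rename-id (lam M)   = cong lam (≡.trans (rename-cong extR-id M) (rename-id M))
rename-id (app M N) = cong₂ app (rename-id M) (rename-id N)
rename-id (con c)   = refl

rename-rename : (r' : Ren Δ Θ) (r : Ren Γ Δ) (M : Tm C Γ σ) →
                rename r' (rename r M) ≡ rename (λ x → r' (r x)) M
rename-rename r' r (var x)   = refl
rename-rename r' r (lam M)   =
  cong lam (≡.trans (rename-rename (extR r') (extR r) M) (rename-cong (extR-∘ r' r) M))
rename-rename r' r (app M N) = cong₂ app (rename-rename r' r M) (rename-rename r' r N)
rename-rename r' r (con c)   = refl

rename-weaken : (r : Ren Γ Δ) (M : Tm C Γ σ) →
                rename (extR {τ = τ} r) (weaken M) ≡ weaken (rename r M)
rename-weaken r M = ≡.trans (rename-rename (extR r) there M) (≡.sym (rename-rename there r M))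

rename-subst : (r : Ren Δ Θ) (s : Sub C Γ Δ) (M : Tm C Γ σ) →
               rename r (subst s M) ≡ subst (λ x → rename r (s x)) M
rename-subst r s (var x)   = refl
rename-subst r s (lam M)   =
  cong lam (≡.trans (rename-subst (extR r) (extS s) M) (subst-cong extR-extS M))
  where
  extR-extS : (λ x → rename (extR r) (extS s x)) ≐ extS (λ x → rename r (s x))
  extR-extS here      = refl
  extR-extS (there x) = rename-weaken r (s x)
rename-subst r s (app M N) = cong₂ app (rename-subst r s M) (rename-subst r s N)
rename-subst r s (con c)   = refl

subst-rename : (s : Sub C Δ Θ) (r : Ren Γ Δ) (M : Tm C Γ σ) →
               subst s (rename r M) ≡ subst (λ x → s (r x)) M
subst-rename s r (var x)   = refl
subst-rename s r (lam M)   =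
  cong lam (≡.trans (subst-rename (extS s) (extR r) M) (subst-cong extS-extR M))
  where
  extS-extR : (λ x → extS s (extR r x)) ≐ extS (λ x → s (r x))
  extS-extR here      = refl
  extS-extR (there x) = refl
subst-rename s r (app M N) = cong₂ app (subst-rename s r M) (subst-rename s r N)
subst-rename s r (con c)   = refl

subst-var : (r : Ren Γ Δ) (M : Tm C Γ σ) → subst (λ x → var (r x)) M ≡ rename r M
subst-var r (var x)   = refl
subst-var r (lam M)   = cong lam (≡.trans (subst-cong extS-var M) (subst-var (extR r) M))
  where
  extS-var : extS (λ x → var (r x)) ≐ λ x → var (extR r x)
  extS-var here      = refl
  extS-var (there x) = refl
subst-var r (app M N) = cong₂ app (subst-var r M) (subst-var r N)
subst-var r (con c)   = refl

subst-id : (M : Tm C Γ σ) → subst var M ≡ M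
subst-id M = ≡.trans (subst-var (λ x → x) M) (rename-id M)

subst-weaken : (s : Sub C Γ Δ) (M : Tm C Γ σ) →
               subst (extS {τ = τ} s) (weaken M) ≡ weaken (subst s M)
subst-weaken s M = ≡.trans (subst-rename (extS s) there M) (≡.sym (rename-subst there s M))

subst-subst : (s' : Sub C Δ Θ) (s : Sub C Γ Δ) (M : Tm C Γ σ) →
              subst s' (subst s M) ≡ subst (λ x → subst s' (s x)) M
subst-subst s' s (var x)   = refl
subst-subst s' s (lam M)   =
  cong lam (≡.trans (subst-subst (extS s') (extS s) M) (subst-cong extS-extS M))
  where
  extS-extS : (λ x → subst (extS s') (extS s x)) ≐ extS (λ x → subst s' (s x))
  extS-extS here      = refl
  extS-extS (there x) = subst-weaken s' (s x)
subst-subst s' s (app M N) = cong₂ app (subst-subst s' s M) (subst-subst s' s N)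
subst-subst s' s (con c)   = refl

weaken-[] : (M : Tm C Γ σ) (N : Tm C Γ τ) → weaken M [ N ] ≡ M
weaken-[] M N = ≡.trans (subst-rename (single N) there M) (subst-id M)

rename-[] : (r : Ren Γ Δ) (M : Tm C (Γ , τ) σ) (N : Tm C Γ τ) →
            rename r (M [ N ]) ≡ rename (extR r) M [ rename r N ]
rename-[] r M N =
  ≡.trans (rename-subst r (single N) M)
    (≡.trans (subst-cong rename-single M)
             (≡.sym (subst-rename (single (rename r N)) (extR r) M)))
  where
  rename-single : (λ x → rename r (single N x)) ≐ λ x → single (rename r N) (extR r x)
  rename-single here      = refl
  rename-single (there x) = refl

infixl 5 _▸ₛ_
_▸ₛ_ : Sub C Γ Δ → Tm C Δ σ → Sub C (Γ , σ) Δ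
(s ▸ₛ u) here      = u
(s ▸ₛ u) (there x) = s x

subst-extS-[] : (s : Sub C Γ Δ) (M : Tm C (Γ , σ) τ) (u : Tm C Δ σ) →
                subst (extS s) M [ u ] ≡ subst (s ▸ₛ u) M
subst-extS-[] s M u = ≡.trans (subst-subst (single u) (extS s) M) (subst-cong single-extS M)
  where
  single-extS : (λ x → subst (single u) (extS s x)) ≐ s ▸ₛ u
  single-extS here      = refl
  single-extS (there x) = weaken-[] (s x) u

β-subst : {Ax : Axioms C} (s : Sub C Γ Δ) (M : Tm C (Γ , σ) τ) (u : Tm C Δ σ) →
          Ax ⊢ app (subst s (lam M)) u ≈ subst (s ▸ₛ u) M
β-subst {Ax = Ax} s M u =
  ≡.subst (Ax ⊢ app (subst s (lam M)) u ≈_) (subst-extS-[] s M u) (β _ u)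

≈-rename : {Ax : Axioms C} →
           (∀ {Γ Δ σ} (r : Ren Γ Δ) {M N : Tm C Γ σ} →
              Ax M N → Ax (rename r M) (rename r N)) →
           (r : Ren Γ Δ) {M N : Tm C Γ σ} →
           Ax ⊢ M ≈ N → Ax ⊢ rename r M ≈ rename r N
≈-rename ax-rename r (ax a)      = ax (ax-rename r a)
≈-rename ax-rename r refl        = refl
≈-rename ax-rename r (sym d)     = sym (≈-rename ax-rename r d)
≈-rename ax-rename r (trans d e) = trans (≈-rename ax-rename r d) (≈-rename ax-rename r e)
≈-rename ax-rename r (app d e)   = app (≈-rename ax-rename r d) (≈-rename ax-rename r e)
≈-rename ax-rename r (lam d)     = lam (≈-rename ax-rename (extR r) d)
≈-rename {Ax = Ax} ax-rename r (β M N) =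
  ≡.subst (Ax ⊢ app (lam (rename (extR r) M)) (rename r N) ≈_) (≡.sym (rename-[] r M N))
          (β (rename (extR r) M) (rename r N))
≈-rename {Ax = Ax} ax-rename r (η M) =
  ≡.subst (λ M' → Ax ⊢ lam (app M' (var here)) ≈ rename r M) (≡.sym (rename-weaken r M))
          (η (rename r M))

≈Y-rename : (r : Ren Γ Δ) {M N : Tm YCon Γ σ} →
            YAx ⊢ M ≈ N → YAx ⊢ rename r M ≈ rename r N
≈Y-rename = ≈-rename λ { r (fix f) → fix (rename r f) }

infix 4 _⊆_
data _⊆_ : Ctx → Ctx → Set where
  ⊆-refl : Γ ⊆ Γ
  ⊆-skip : Γ ⊆ Δ → Γ ⊆ Δ , σ

toRen : Γ ⊆ Δ → Ren Γ Δ
toRen ⊆-refl     x = x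
toRen (⊆-skip w) x = there (toRen w x)

⊆-trans : Γ ⊆ Δ → Δ ⊆ Θ → Γ ⊆ Θ
⊆-trans w ⊆-refl      = w
⊆-trans w (⊆-skip w') = ⊆-skip (⊆-trans w w')

toRen-trans : (w : Γ ⊆ Δ) (w' : Δ ⊆ Θ) →
              toRen (⊆-trans w w') ≐ λ x → toRen w' (toRen w x)
toRen-trans w ⊆-refl      x = refl
toRen-trans w (⊆-skip w') x = cong there (toRen-trans w w' x)

rename-trans : (w : Γ ⊆ Δ) (w' : Δ ⊆ Θ) (M : Tm C Γ σ) →
               rename (toRen (⊆-trans w w')) M ≡ rename (toRen w') (rename (toRen w) M)
rename-trans w w' M =
  ≡.trans (rename-cong (toRen-trans w w') M) (≡.sym (rename-rename (toRen w') (toRen w) M))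

length : Ctx → ℕ
length ∅       = 0
length (Γ , _) = suc (length Γ)

level : Γ ∋ σ → ℕ
level {Γ = Γ , _} here = length Γ
level (there x)        = level x

level<length : (x : Γ ∋ σ) → level x < length Γ
level<length here      = ≤-refl
level<length (there x) = m≤n⇒m≤1+n (level<length x)

⊆-length : Γ ⊆ Δ → length Γ ≤ length Δ
⊆-length ⊆-refl     = ≤-refl
⊆-length (⊆-skip w) = m≤n⇒m≤1+n (⊆-length w)

_≟ᵀ_ : DecidableEquality Ty
o       ≟ᵀ o         = yes refl
o       ≟ᵀ (_ ⇒ _)   = no λ ()
(_ ⇒ _) ≟ᵀ o         = no λ ()
(σ ⇒ τ) ≟ᵀ (σ' ⇒ τ') with σ ≟ᵀ σ' | τ ≟ᵀ τ'
... | yes refl | yes refl = yes refl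
... | no σ≢σ'  | _        = no λ { refl → σ≢σ' refl }
... | _        | no τ≢τ'  = no λ { refl → τ≢τ' refl }

hereAt : Dec (τ ≡ σ) → Maybe (Δ , τ ∋ σ)
hereAt (yes refl) = just here
hereAt (no _)     = nothing

varAt : (Δ : Ctx) → ℕ → (σ : Ty) → Maybe (Δ ∋ σ)
varAt ∅       k σ = nothing
varAt (Δ , τ) k σ =
  if does (k ≟ length Δ) then hereAt (τ ≟ᵀ σ) else map there (varAt Δ k σ)

varAt-level : (x : Γ ∋ σ) → varAt Γ (level x) σ ≡ just x
varAt-level {Γ = Γ , σ} here
  rewrite dec-true (length Γ ≟ length Γ) refl | ≡-≟-identity _≟ᵀ_ (refl {x = σ}) = refl
varAt-level {Γ = Γ , _} (there x)
  rewrite dec-false (level x ≟ length Γ) (<⇒≢ (level<length x)) | varAt-level x = refl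

varAt-level-⊆ : (x : Γ ∋ σ) (w : Γ ⊆ Δ) → varAt Δ (level x) σ ≡ just (toRen w x)
varAt-level-⊆ x ⊆-refl = varAt-level x
varAt-level-⊆ {Δ = Δ , _} x (⊆-skip w)
  rewrite dec-false (level x ≟ length Δ) (<⇒≢ (<-≤-trans (level<length x) (⊆-length w)))
        | varAt-level-⊆ x w = refl

-- A base value is a partial term in every context. Variables are named by de Bruijn
-- level, so a value built in Γ means the same thing in every extension of Γ.
Fam : Ty → Set
Fam σ = (Δ : Ctx) → Maybe (Tm YCon Δ σ)

D : Ty → Set
D o       = Fam o
D (σ ⇒ τ) = D σ → D τ

varFam : Γ ∋ σ → Fam σ
varFam {σ = σ} x Δ = map var (varAt Δ (level x) σ)

fresh : (Δ : Ctx) (σ : Ty) → Fam σ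
fresh Δ σ = varFam {Δ , σ} here

mutual
  reify : ∀ σ → D σ → Fam σ
  reify o       v   = v
  reify (σ ⇒ τ) f Δ = map lam (reify τ (f (reflect σ (fresh Δ σ))) (Δ , σ))

  reflect : ∀ σ → Fam σ → D σ
  reflect o       n   = n
  reflect (σ ⇒ τ) n v = reflect τ (λ Δ → zipWith app (n Δ) (reify σ v Δ))

undefined : ∀ σ → D σ
undefined o       _ = nothing
undefined (σ ⇒ τ) _ = undefined τ

Env : Ctx → Set
Env Γ = ∀ {σ} → Γ ∋ σ → D σ

infixl 5 _▸_
_▸_ : Env Γ → D σ → Env (Γ , σ)
(ρ ▸ v) here      = v
(ρ ▸ v) (there x) = ρ x

eval : Tm ΩCon Γ σ → Env Γ → D σ
eval (var x)     ρ = ρ x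
eval (lam M)     ρ = λ v → eval M (ρ ▸ v)
eval (app M N)   ρ = eval M ρ (eval N ρ)
eval (con (Ω σ)) ρ = undefined σ

idEnv : Env Γ
idEnv {σ = σ} x = reflect σ (varFam x)

-- Soundness of the model for λΩ⁺ conversion

_≈ᴹ_ : Maybe (Tm YCon Δ σ) → Maybe (Tm YCon Δ σ) → Set
_≈ᴹ_ = Pointwise (YAx ⊢_≈_)

zipWith-app-≈ᴹ : {f f' : Maybe (Tm YCon Δ (σ ⇒ τ))} {a a' : Maybe (Tm YCon Δ σ)} →
                 f ≈ᴹ f' → a ≈ᴹ a' → zipWith app f a ≈ᴹ zipWith app f' a'
zipWith-app-≈ᴹ (just d) (just e) = just (app d e)
zipWith-app-≈ᴹ (just d) nothing  = nothing
zipWith-app-≈ᴹ nothing  _        = nothing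

map-lam-≈ᴹ : {a a' : Maybe (Tm YCon (Δ , σ) τ)} →
             a ≈ᴹ a' → map lam a ≈ᴹ map lam a'
map-lam-≈ᴹ (just d) = just (lam d)
map-lam-≈ᴹ nothing  = nothing

≈ᴹ-refl : {a : Maybe (Tm YCon Δ σ)} → a ≈ᴹ a
≈ᴹ-refl = Pointwise.refl refl

Eqv : ∀ σ → D σ → D σ → Set
Eqv o       v v' = ∀ Δ → v Δ ≈ᴹ v' Δ
Eqv (σ ⇒ τ) f f' = ∀ {v v'} → Eqv σ v v' → Eqv τ (f v) (f' v')

mutual
  Eqv-sym : ∀ σ {v v'} → Eqv σ v v' → Eqv σ v' v
  Eqv-sym o       e Δ  = Pointwise.sym sym (e Δ)
  Eqv-sym (σ ⇒ τ) e ev = Eqv-sym τ (e (Eqv-sym σ ev))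

  Eqv-trans : ∀ σ {v v' v''} → Eqv σ v v' → Eqv σ v' v'' → Eqv σ v v''
  Eqv-trans o       e e' Δ  = Pointwise.trans trans (e Δ) (e' Δ)
  Eqv-trans (σ ⇒ τ) e e' ev = Eqv-trans τ (e ev) (e' (Eqv-trans σ (Eqv-sym σ ev) ev))

Eqv-reflˡ : ∀ σ {v v'} → Eqv σ v v' → Eqv σ v v
Eqv-reflˡ σ e = Eqv-trans σ e (Eqv-sym σ e)

Eqv-reflʳ : ∀ σ {v v'} → Eqv σ v v' → Eqv σ v' v'
Eqv-reflʳ σ e = Eqv-trans σ (Eqv-sym σ e) e

undefined-Eqv : ∀ σ → Eqv σ (undefined σ) (undefined σ)
undefined-Eqv o       Δ = nothing
undefined-Eqv (σ ⇒ τ) _ = undefined-Eqv τ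

mutual
  reify-Eqv : ∀ σ {v v'} → Eqv σ v v' → ∀ Δ → reify σ v Δ ≈ᴹ reify σ v' Δ
  reify-Eqv o       e Δ = e Δ
  reify-Eqv (σ ⇒ τ) e Δ =
    map-lam-≈ᴹ (reify-Eqv τ (e (reflect-Eqv σ λ _ → ≈ᴹ-refl)) (Δ , σ))

  reflect-Eqv : ∀ σ {n n' : Fam σ} →
                (∀ Δ → n Δ ≈ᴹ n' Δ) → Eqv σ (reflect σ n) (reflect σ n')
  reflect-Eqv o       e    = e
  reflect-Eqv (σ ⇒ τ) e ev =
    reflect-Eqv τ λ Δ → zipWith-app-≈ᴹ (e Δ) (reify-Eqv σ ev Δ)

EnvEqv : Env Γ → Env Γ → Set
EnvEqv {Γ} ρ ρ' = ∀ {σ} (x : Γ ∋ σ) → Eqv σ (ρ x) (ρ' x)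

▸-Eqv : {ρ ρ' : Env Γ} {v v' : D σ} →
        EnvEqv ρ ρ' → Eqv σ v v' → EnvEqv (ρ ▸ v) (ρ' ▸ v')
▸-Eqv e ev here      = ev
▸-Eqv e ev (there x) = e x

idEnv-Eqv : EnvEqv {Γ} idEnv idEnv
idEnv-Eqv {σ = σ} x = reflect-Eqv σ λ _ → ≈ᴹ-refl

eval-Eqv : (M : Tm ΩCon Γ σ) {ρ ρ' : Env Γ} →
           EnvEqv ρ ρ' → Eqv σ (eval M ρ) (eval M ρ')
eval-Eqv (var x)     e    = e x
eval-Eqv (lam M)     e ev = eval-Eqv M (▸-Eqv e ev)
eval-Eqv (app M N)   e    = eval-Eqv M e (eval-Eqv N e)
eval-Eqv (con (Ω σ)) e    = undefined-Eqv σ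

eval-rename : (r : Ren Γ Δ) (M : Tm ΩCon Γ σ) {ρ : Env Δ} {ρ' : Env Γ} →
              EnvEqv (λ x → ρ (r x)) ρ' → Eqv σ (eval (rename r M) ρ) (eval M ρ')
eval-rename r (var x)     e    = e x
eval-rename r (lam M)     e ev = eval-rename (extR r) M λ { here → ev ; (there x) → e x }
eval-rename r (app M N)   e    = eval-rename r M e (eval-rename r N e)
eval-rename r (con (Ω σ)) e    = undefined-Eqv σ

eval-subst : (s : Sub ΩCon Γ Δ) (M : Tm ΩCon Γ σ) {ρ : Env Δ} {ρ' : Env Γ} →
             EnvEqv ρ ρ → EnvEqv (λ x → eval (s x) ρ) ρ' →
             Eqv σ (eval (subst s M) ρ) (eval M ρ')
eval-subst s (var x)     ρ≈ρ e    = e x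
eval-subst s (lam M)     ρ≈ρ e ev =
  eval-subst (extS s) M (▸-Eqv ρ≈ρ (Eqv-reflˡ _ ev))
    λ { here → ev ; {τ} (there x) → Eqv-trans τ (eval-rename there (s x) ρ≈ρ) (e x) }
eval-subst s (app M N)   ρ≈ρ e    = eval-subst s M ρ≈ρ e (eval-subst s N ρ≈ρ e)
eval-subst s (con (Ω σ)) ρ≈ρ e    = undefined-Eqv σ

eval-sound : {A B : Tm ΩCon Γ σ} → noAx ⊢ A ≈ B →
             {ρ ρ' : Env Γ} → EnvEqv ρ ρ' → Eqv σ (eval A ρ) (eval B ρ')
eval-sound (ax ())
eval-sound {A = A} refl    e = eval-Eqv A e
eval-sound {σ = σ} (sym d) e = Eqv-sym σ (eval-sound d λ {τ} x → Eqv-sym τ (e x))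
eval-sound {σ = σ} (trans d d') e =
  Eqv-trans σ (eval-sound d λ {τ} x → Eqv-reflˡ τ (e x)) (eval-sound d' e)
eval-sound (app d d') e    = eval-sound d e (eval-sound d' e)
eval-sound (lam d)    e ev = eval-sound d (▸-Eqv e ev)
eval-sound {σ = σ} (β M N) {ρ' = ρ'} e =
  Eqv-trans σ (eval-Eqv M (▸-Eqv e (eval-Eqv N e)))
    (Eqv-sym σ (eval-subst (single N) M ρ'≈ρ'
                  λ { here → eval-Eqv N ρ'≈ρ' ; (there x) → ρ'≈ρ' x }))
  where
  ρ'≈ρ' : EnvEqv ρ' ρ'
  ρ'≈ρ' {τ} x = Eqv-reflʳ τ (e x)
eval-sound (η M)      e ev = eval-rename there M e ev

-- Values tracked by λY terms

-- Approximants may read back to nothing (Ω is undefined), pure terms may not.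
data Mode : Set where
  partial total : Mode

Lift : Mode → {A : Set} → (A → Set) → Maybe A → Set
Lift partial = All
Lift total   = Any

ReadsBack : Mode → Maybe (Tm YCon Δ σ) → Tm YCon Δ σ → Set
ReadsBack m a t = Lift m (YAx ⊢_≈ t) a

ReadsBack-≈ : ∀ m {a : Maybe (Tm YCon Δ σ)} {t t'} →
              YAx ⊢ t ≈ t' → ReadsBack m a t → ReadsBack m a t'
ReadsBack-≈ partial d = All.map λ d' → trans d' d
ReadsBack-≈ total   d = Any.map λ d' → trans d' d

ReadsBack-just : ∀ m (t : Tm YCon Δ σ) → ReadsBack m (just t) t
ReadsBack-just partial t = just refl
ReadsBack-just total   t = just refl

ReadsBack-app : ∀ m {f : Maybe (Tm YCon Δ (σ ⇒ τ))} {a t u} →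
                ReadsBack m f t → ReadsBack m a u → ReadsBack m (zipWith app f a) (app t u)
ReadsBack-app partial (just d) (just e) = just (app d e)
ReadsBack-app partial (just d) nothing  = nothing
ReadsBack-app partial nothing  _        = nothing
ReadsBack-app total   (just d) (just e) = just (app d e)

ReadsBack-lam : ∀ m {a : Maybe (Tm YCon (Δ , σ) τ)} {t} →
                ReadsBack m a t → ReadsBack m (map lam a) (lam t)
ReadsBack-lam partial (just d) = just (lam d)
ReadsBack-lam partial nothing  = nothing
ReadsBack-lam total   (just d) = just (lam d)

TracksFam : Mode → ∀ σ → Fam σ → Tm YCon Δ σ → Set
TracksFam {Δ} m σ n t = ∀ {Δ'} (w : Δ ⊆ Δ') → ReadsBack m (n Δ') (rename (toRen w) t)

Tracks : Mode → ∀ σ → D σ → Tm YCon Δ σ → Set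
Tracks     m o       v t = TracksFam m o v t
Tracks {Δ} m (σ ⇒ τ) f t =
  ∀ {Δ'} (w : Δ ⊆ Δ') {v u} →
  Tracks m σ v u → Tracks m τ (f v) (app (rename (toRen w) t) u)

Tracks-≈ : ∀ m σ {v : D σ} {t t' : Tm YCon Δ σ} →
           YAx ⊢ t ≈ t' → Tracks m σ v t → Tracks m σ v t'
Tracks-≈ m o       d r w    = ReadsBack-≈ m (≈Y-rename (toRen w) d) (r w)
Tracks-≈ m (σ ⇒ τ) d r w rv = Tracks-≈ m τ (app (≈Y-rename (toRen w) d) refl) (r w rv)

Tracks-rename : ∀ m σ {v : D σ} {t : Tm YCon Δ σ} (w : Δ ⊆ Θ) →
                Tracks m σ v t → Tracks m σ v (rename (toRen w) t)
Tracks-rename m o {v} {t} w r w' =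
  ≡.subst (ReadsBack m (v _)) (rename-trans w w' t) (r (⊆-trans w w'))
Tracks-rename m (σ ⇒ τ) {f} {t} w r w' {v} {u} rv =
  ≡.subst (λ t' → Tracks m τ (f v) (app t' u)) (rename-trans w w' t) (r (⊆-trans w w') rv)

varFam-Tracks : ∀ m (x : Γ ∋ σ) → TracksFam m σ (varFam x) (var x)
varFam-Tracks m x w =
  ≡.subst (λ a → ReadsBack m (map var a) (var (toRen w x))) (≡.sym (varAt-level-⊆ x w))
          (ReadsBack-just m _)

mutual
  reflect-Tracks : ∀ m σ {n : Fam σ} {t : Tm YCon Δ σ} →
                   TracksFam m σ n t → Tracks m σ (reflect σ n) t
  reflect-Tracks m o       r = r
  reflect-Tracks m (σ ⇒ τ) {n} {t} r w rv = reflect-Tracks m τ λ w' →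
    ReadsBack-app m (≡.subst (ReadsBack m (n _)) (rename-trans w w' t) (r (⊆-trans w w')))
                    (reify-Tracks m σ rv w')

  reify-Tracks : ∀ m σ {v : D σ} {t : Tm YCon Δ σ} →
                 Tracks m σ v t → TracksFam m σ (reify σ v) t
  reify-Tracks m o       r = r
  reify-Tracks m (σ ⇒ τ) {f} {t} r {Δ'} w =
    ReadsBack-≈ m (η (rename (toRen w) t))
      (ReadsBack-lam m (≡.subst (ReadsBack m _) (rename-id _) (reify-Tracks m τ body ⊆-refl)))
    where
    body : Tracks m τ (f (reflect σ (fresh Δ' σ)))
                      (app (weaken (rename (toRen w) t)) (var here))
    body = ≡.subst (λ t' → Tracks m τ _ (app t' (var here)))
                   (≡.sym (rename-rename there (toRen w) t))
                   (r (⊆-skip w) (reflect-Tracks m σ (varFam-Tracks m here)))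

undefined-Tracks : ∀ σ {t : Tm YCon Δ σ} → Tracks partial σ (undefined σ) t
undefined-Tracks o       w    = nothing
undefined-Tracks (σ ⇒ τ) w rv = undefined-Tracks τ

EnvTracks : Mode → Env Γ → Sub YCon Γ Δ → Set
EnvTracks {Γ} m ρ s = ∀ {σ} (x : Γ ∋ σ) → Tracks m σ (ρ x) (s x)

idEnv-Tracks : ∀ m → EnvTracks m (idEnv {Γ}) var
idEnv-Tracks m {σ = σ} x = reflect-Tracks m σ (varFam-Tracks m x)

lam-Tracks : ∀ m {ρ : Env Γ} {s : Sub YCon Γ Δ}
             (M : Tm YCon (Γ , σ) τ) (⟦M⟧ : Env (Γ , σ) → D τ) →
             (∀ {Δ'} {ρ' : Env (Γ , σ)} {s' : Sub YCon (Γ , σ) Δ'} →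
                EnvTracks m ρ' s' → Tracks m τ (⟦M⟧ ρ') (subst s' M)) →
             EnvTracks m ρ s →
             Tracks m (σ ⇒ τ) (λ v → ⟦M⟧ (ρ ▸ v)) (subst s (lam M))
lam-Tracks {τ = τ} m {s = s} M ⟦M⟧ ⟦M⟧-Tracks ρs w {u = u} rv =
  Tracks-≈ m τ (sym β-rename)
    (⟦M⟧-Tracks λ { here → rv ; {σ'} (there x) → Tracks-rename m σ' w (ρs x) })
  where
  s' = λ {σ'} x → rename (toRen w) (s {σ'} x)
  β-rename : YAx ⊢ app (rename (toRen w) (subst s (lam M))) u ≈ subst (s' ▸ₛ u) M
  β-rename = ≡.subst (λ t → YAx ⊢ app t u ≈ subst (s' ▸ₛ u) M)
                     (≡.sym (rename-subst (toRen w) s (lam M))) (β-subst s' M u)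

approx-Tracks : (M : Tm YCon Γ σ) (ns : Vec ℕ (occ M)) {ρ : Env Γ} {s : Sub YCon Γ Δ} →
                EnvTracks partial ρ s → Tracks partial σ (eval (approx M ns) ρ) (subst s M)
approx-Tracks (var x)   ns ρs = ρs x
approx-Tracks (lam M)   ns ρs = lam-Tracks partial M (eval (approx M ns)) (approx-Tracks M ns) ρs
approx-Tracks {σ = σ} (app M N) ns {s = s} ρs =
  ≡.subst (λ t → Tracks partial σ _ (app t (subst s N))) (rename-id (subst s M))
          (approx-Tracks M _ ρs ⊆-refl (approx-Tracks N _ ρs))
approx-Tracks {Γ} (con (Y σ)) ns {ρ} ρs w {f} {g} fg = iterate-Tracks (head ns)
  where
  -- f (fⁿ(Ω)) is tracked by g (Y g), which is λY-equal to Y g.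
  iterate-Tracks : ∀ n →
                   Tracks partial σ (eval (iterΩ {Γ} σ n) (ρ ▸ f)) (app (con (Y σ)) g)
  iterate-Tracks zero    = undefined-Tracks σ
  iterate-Tracks (suc n) =
    Tracks-≈ partial σ (ax (fix g))
      (≡.subst (λ t → Tracks partial σ _ (app t (app (con (Y σ)) g))) (rename-id g)
               (fg ⊆-refl (iterate-Tracks n)))

embed-Tracks : (K : Tm NoCon Γ σ) {ρ : Env Γ} {s : Sub YCon Γ Δ} →
               EnvTracks total ρ s → Tracks total σ (eval (embed K) ρ) (subst s (embed K))
embed-Tracks (var x)   ρs = ρs x
embed-Tracks (lam K)   ρs = lam-Tracks total (embed K) (eval (embed K)) (embed-Tracks K) ρs
embed-Tracks {σ = σ} (app K L) {s = s} ρs =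
  ≡.subst (λ t → Tracks total σ _ (app t (subst s (embed L)))) (rename-id (subst s (embed K)))
          (embed-Tracks K ρs ⊆-refl (embed-Tracks L ρs))
embed-Tracks (con ())

readBack-agree : {a b : Maybe (Tm YCon Δ σ)} {t u : Tm YCon Δ σ} →
                 a ≈ᴹ b → ReadsBack partial a t → ReadsBack total b u → YAx ⊢ t ≈ u
readBack-agree (just d) (just dt) (just du) = trans (sym dt) (trans d du)

lemma3 : ∀ {Γ σ} (M : Tm YCon Γ σ) (ns : Vec ℕ (occ M)) (K : Tm NoCon Γ σ) →
    noAx ⊢ approx M ns ≈ embed K → YAx ⊢ M ≈ embed K
lemma3 {Γ} {σ} M ns K d =
  ≡.subst₂ (YAx ⊢_≈_) (readBack-id M) (readBack-id (embed K))
    (readBack-agree (reify-Eqv σ (eval-sound d idEnv-Eqv) Γ)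
                    (reify-Tracks partial σ (approx-Tracks M ns (idEnv-Tracks partial)) ⊆-refl)
                    (reify-Tracks total σ (embed-Tracks K (idEnv-Tracks total)) ⊆-refl))
  where
  readBack-id : (t : Tm YCon Γ σ) → rename (λ x → x) (subst var t) ≡ t
  readBack-id t = ≡.trans (rename-id _) (subst-id t)
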